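{- Let $k\ge1$. For $m>j\ge 2$, \[ GL_k(k(m-1)+1,j)=(z^{j-1}+z^j)q^{k\binom{j}{2}+j+k(m-1)}{m-2\brack j-1}_k. \]
   Context: Overpartitions here are non-increasing sequences of positive integers in which the last occurrence of each distinct part value may be overlined; a part $t$ or $\overline t$ has size $t$, written $|\cdot|=t$; $|\lambda|$ is the sum of part sizes and $\ell_o(\lambda)$ the number of overlined parts. An $L_k$-overpartition is an overpartition $\pi=(\pi_1,\ldots,\pi_\ell)$ such that whenever $\pi_i$ is overlined, $\ell-i\equiv 0\pmod k$. For $m\ge1$, $\mathcal{BL}_k(m)$ is the set of $L_k$-overpartitions $\lambda=(\lambda_1,\ldots,\lambda_m)$ with exactly $m$ parts such that $\lambda_m=\overline1$ or $1$, and for $1\le i<m$, $|\lambda_i|\le|\lambda_{i+1}|+1$, with strict inequality if $\lambda_i$ is non-overlined. For $m,j\ge1$, $\mathcal{BL}_k(m,j)$ is the set of overpartitions in $\mathcal{BL}_k(m)$ whose largest part is (non-overlined) $j$, and $GL_k(m,j)=\sum_{\lambda\in\mathcal{BL}_k(m,j)}z^{\ell_o(\lambda)}q^{|\lambda|}$. Also ${A\brack B}_k=\frac{(q^k;q^k)_A}{(q^k;q^k)_B(q^k;q^k)_{A-B}}$ for $A\ge B\ge0$ and $0$ otherwise. -}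

module Defs where

open import Data.Nat using (ℕ; zero; suc; _+_; _*_; _∸_; _%_; _≡ᵇ_; _<ᵇ_)
open import Data.Nat.Combinatorics using (_C_)
open import Data.Bool using (Bool; true; false; _∧_; _∨_; not; if_then_else_)
open import Data.Product using (_×_; _,_; proj₁; proj₂)
open import Data.List using (List; []; _∷_; length; map; concatMap; filter; upTo; foldr)
open import Data.Integer as ℤ using (ℤ; +_)
open import Relation.Binary.PropositionalEquality using (_≡_)
open import Relation.Nullary.Decidable using (Dec; yes; no)
open import Data.Bool using (T)
open import Data.Bool.Properties using (T?)

-- Overpartitions
-- A part is (size , overlined?).  A list (λ₁ , … , λ_ℓ) is read left to
-- right with λ₁ the FIRST (largest) part.

Part : Set
Part = ℕ × Bool

size : Part → ℕ
size = proj₁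

over : Part → Bool
over = proj₂

_≤ᵇ_ : ℕ → ℕ → Bool
a ≤ᵇ b = a <ᵇ suc b

weight : List Part → ℕ
weight = foldr (λ p s → size p + s) 0

numOver : List Part → ℕ
numOver = foldr (λ p s → (if over p then 1 else 0) + s) 0

-- consecutive-part conditions for an overpartition:
-- non-increasing, and an overlined part is the last occurrence of its value
ovAdj : Part → Part → Bool
ovAdj p q = (size q ≤ᵇ size p) ∧ (not (over p) ∨ (size q <ᵇ size p))

isOverpartition : List Part → Bool
isOverpartition [] = true
isOverpartition (p ∷ []) = 1 ≤ᵇ size p
isOverpartition (p ∷ q ∷ xs) = (1 ≤ᵇ size p) ∧ ovAdj p q ∧ isOverpartition (q ∷ xs)

-- L_k condition: if λ_i is overlined then ℓ - i ≡ 0 (mod k);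
-- ℓ - i is the number of parts after λ_i.
-- k ∣ n as a boolean (for k = 0: n = 0)
divides? : ℕ → ℕ → Bool
divides? zero n = n ≡ᵇ 0
divides? (suc k) n = (n % suc k) ≡ᵇ 0

isLk : ℕ → List Part → Bool
isLk k [] = true
isLk k (p ∷ xs) = (not (over p) ∨ divides? k (length xs)) ∧ isLk k xs

lastIsOne : List Part → Bool
lastIsOne [] = false
lastIsOne (p ∷ []) = size p ≡ᵇ 1
lastIsOne (p ∷ q ∷ xs) = lastIsOne (q ∷ xs)

blAdj : List Part → Bool
blAdj [] = true
blAdj (p ∷ []) = true
blAdj (p ∷ q ∷ xs) =
  (size p ≤ᵇ (size q + 1)) ∧ (over p ∨ (size p <ᵇ (size q + 1))) ∧ blAdj (q ∷ xs)

isBL : ℕ → ℕ → List Part → Bool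
isBL k m λs = isOverpartition λs ∧ isLk k λs ∧ (length λs ≡ᵇ m) ∧ lastIsOne λs ∧ blAdj λs

largestIs : ℕ → List Part → Bool
largestIs j [] = false
largestIs j (p ∷ xs) = (size p ≡ᵇ j) ∧ not (over p)

isBLj : ℕ → ℕ → ℕ → List Part → Bool
isBLj k m j λs = isBL k m λs ∧ largestIs j λs

-- Every λ ∈ BL_k(m,j) has exactly m parts, each of
-- size ≤ j (non-increasing, largest part j), so it occurs (exactly once)
-- in the list of all length-m lists of parts with sizes in {0,…,j}.

allLists : {A : Set} → ℕ → List A → List (List A)
allLists zero xs = [] ∷ []
allLists (suc n) xs = concatMap (λ x → map (x ∷_) (allLists n xs)) xs

partsUpTo : ℕ → List Part
partsUpTo j = concatMap (λ s → (s , false) ∷ (s , true) ∷ []) (upTo (suc j))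

BLlist : ℕ → ℕ → ℕ → List (List Part)
BLlist k m j = filter (λ λs → T? (isBLj k m j λs)) (allLists m (partsUpTo j))

-- Formal power series in z, q over ℤ: f a n = coefficient of z^a q^n.

Series : Set
Series = ℕ → ℕ → ℤ

_≈_ : Series → Series → Set
f ≈ g = ∀ a n → f a n ≡ g a n

_⊕_ : Series → Series → Series
(f ⊕ g) a n = f a n ℤ.+ g a n

_⊖_ : Series → Series → Series
(f ⊖ g) a n = f a n ℤ.- g a n

sumℤ : List ℤ → ℤ
sumℤ = foldr ℤ._+_ (+ 0)

_⊗_ : Series → Series → Series
(f ⊗ g) a n =
  sumℤ (concatMap (λ a₁ → map (λ n₁ → f a₁ n₁ ℤ.* g (a ∸ a₁) (n ∸ n₁)) (upTo (suc n)))
                  (upTo (suc a)))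

infixl 6 _⊕_ _⊖_
infixl 7 _⊗_
infix 4 _≈_

mono : ℕ → ℕ → Series
mono a n a′ n′ = if (a ≡ᵇ a′) ∧ (n ≡ᵇ n′) then + 1 else + 0

one : Series
one = mono 0 0

poch : ℕ → ℕ → Series
poch k zero = one
poch k (suc A) = poch k A ⊗ (one ⊖ mono 0 (k * suc A))

-- GL_k(m,j) = Σ_{λ ∈ BL_k(m,j)} z^{ℓ_o(λ)} q^{|λ|}, as coefficients
GL : ℕ → ℕ → ℕ → Series
GL k m j a n =
  + length (filter (λ λs → T? ((numOver λs ≡ᵇ a) ∧ (weight λs ≡ᵇ n))) (BLlist k m j))

{-# OPTIONS --safe #-}
module Submission where

-- Read from its last part (1 or 1̄) towards its first, an element of BL_k(m) grows one part at a
-- time: a new plain part repeats the size of its successor, a new overlined part exceeds it by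
-- one, and an overlined part must be followed by a multiple of k parts.  Hence the generating
-- function H_m(s) of BL_k(m) by the size s of the first part satisfies
--   H_{m+1}(s) = q^s H_m(s) + [k ∣ m] z q^s H_m(s − 1),
-- which branches only once per block of k parts; across a block it is the q-Pascal rule in
-- Q = q^k, so H_{kt+1}(u+1) = (z^u + z^{u+1}) q^{kt+u+1+k·C(u,2)} [t, u]_Q.  Since
-- GL_k(k(t+1)+1, u+1) = q^{u+1} H_{k(t+1)}(u+1), the theorem follows from
-- [t, u]_Q (Q;Q)_u (Q;Q)_{t−u} = (Q;Q)_t, an identity in the ring ℤ[[q]][[z]].

open import Algebra using (Monoid; CommutativeRing)
open import Algebra.Structures using (IsCommutativeRing)
import Algebra.Construct.Pointwise as Pointwise
import Algebra.Solver.CommutativeMonoid as CMSolver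
open import Data.Nat using (ℕ; zero; suc; _∸_; _≤_; _<_; _≡ᵇ_; _<ᵇ_; _%_; z≤n; s≤s; _≟_)
import Data.Nat as ℕ
import Data.Nat.Properties as ℕₚ
open import Data.Nat.DivMod using ([m+kn]%n≡m%n; m≤n⇒m%n≡m; m*n%n≡0)
open import Data.Nat.Combinatorics using (_C_; nC1≡n; nCk+nC[k+1]≡[n+1]C[k+1])
open import Data.Nat.Tactic.RingSolver using (solve-∀)
open import Data.Integer as ℤ using (ℤ; +_)
open import Data.Integer.Properties using (+-*-commutativeRing)
import Data.Integer.Properties as ℤₚ
open import Data.Bool using (Bool; true; false; if_then_else_; _∧_; _∨_; not; T)
open import Data.Bool.Properties using (T?; ∧-zeroʳ; ∧-identityʳ; ∧-comm; ∧-commutativeMonoid)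
open import Data.Unit using (tt)
open import Data.Product using (_,_)
open import Data.List using (List; []; _∷_; _++_; map; concat; concatMap; foldr; length; filter; upTo; applyUpTo)
open import Data.List.Properties using (map-∘; map-++; map-concatMap; map-applyUpTo)
open import Function using (_∘_)
open import Level using (0ℓ)
open import Relation.Nullary.Decidable using (dec-true; dec-false)
open import Relation.Binary.PropositionalEquality as ≡ using (_≡_; _≢_)

module ListSum {c ℓ} (M : Monoid c ℓ) where
  open Monoid M renaming (_∙_ to _+_; ε to 0#; ∙-cong to +-cong; ∙-congˡ to +-congˡ; assoc to +-assoc;
                          identityˡ to +-identityˡ; identityʳ to +-identityʳ)

  Σ : List Carrier → Carrier
  Σ = foldr _+_ 0#

  Σ-++ : ∀ xs ys → Σ (xs ++ ys) ≈ Σ xs + Σ ys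
  Σ-++ [] ys = sym (+-identityˡ _)
  Σ-++ (x ∷ xs) ys = trans (+-congˡ (Σ-++ xs ys)) (sym (+-assoc x _ _))

  Σ-concat : ∀ xss → Σ (concat xss) ≈ Σ (map Σ xss)
  Σ-concat [] = refl
  Σ-concat (xs ∷ xss) = trans (Σ-++ xs _) (+-congˡ (Σ-concat xss))

  Σ-map-cong : ∀ {a} {B : Set a} {f g : B → Carrier} → (∀ x → f x ≈ g x) → ∀ xs →
               Σ (map f xs) ≈ Σ (map g xs)
  Σ-map-cong f≈g [] = refl
  Σ-map-cong f≈g (x ∷ xs) = +-cong (f≈g x) (Σ-map-cong f≈g xs)

  Σ-map-zero : ∀ {a} {B : Set a} {f : B → Carrier} → (∀ x → f x ≈ 0#) → ∀ xs → Σ (map f xs) ≈ 0#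
  Σ-map-zero f≈0 [] = refl
  Σ-map-zero f≈0 (x ∷ xs) = trans (+-cong (f≈0 x) (Σ-map-zero f≈0 xs)) (+-identityˡ 0#)

  Σ-applyUpTo-zero : ∀ {f : ℕ → Carrier} → (∀ i → f i ≈ 0#) → ∀ n → Σ (applyUpTo f n) ≈ 0#
  Σ-applyUpTo-zero f≈0 zero = refl
  Σ-applyUpTo-zero f≈0 (suc n) = trans (+-cong (f≈0 0) (Σ-applyUpTo-zero (f≈0 ∘ suc) n)) (+-identityˡ 0#)

  Σ-applyUpTo-single : ∀ {f : ℕ → Carrier} {i n} → i < n → (∀ i′ → i′ ≢ i → f i′ ≈ 0#) →
                       Σ (applyUpTo f n) ≈ f i
  Σ-applyUpTo-single {f} {zero} {suc n} _ f≈0 =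
    trans (+-congˡ (Σ-applyUpTo-zero (λ i → f≈0 (suc i) λ ()) n)) (+-identityʳ _)
  Σ-applyUpTo-single {f} {suc i} {suc n} (s≤s i<n) f≈0 =
    trans (+-cong (f≈0 0 λ ()) (Σ-applyUpTo-single i<n (λ i′ i′≢i → f≈0 (suc i′) (i′≢i ∘ ℕₚ.suc-injective))))
          (+-identityˡ _)

-- Formal power series

module PowerSeries {c ℓ} (R : CommutativeRing c ℓ) where
  open CommutativeRing R hiding (isCommutativeRing)
  open import Relation.Binary.Reasoning.Setoid setoid
  open import Algebra.Properties.CommutativeSemigroup +-commutativeSemigroup using (interchange; x∙yz≈y∙xz)
  open ListSum +-monoid

  PS : Set c
  PS = ℕ → Carrier

  infix 4 _≈ₚ_
  infixl 6 _+ₚ_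
  infixl 7 _*ₚ_

  _≈ₚ_ : PS → PS → Set ℓ
  f ≈ₚ g = ∀ n → f n ≈ g n

  _+ₚ_ : PS → PS → PS
  (f +ₚ g) n = f n + g n

  -ₚ_ : PS → PS
  (-ₚ f) n = - f n

  0ₚ : PS
  0ₚ n = 0#

  1ₚ : PS
  1ₚ zero = 1#
  1ₚ (suc n) = 0#

  -- f = f 0 + x (f ∘ suc), hence (f g)ₙ₊₁ = f₀ gₙ₊₁ + ((f ∘ suc) g)ₙ.
  _*ₚ_ : PS → PS → PS
  (f *ₚ g) zero = f 0 * g 0
  (f *ₚ g) (suc n) = f 0 * g (suc n) + ((f ∘ suc) *ₚ g) n

  *ₚ-cong : ∀ {f f′ g g′} → f ≈ₚ f′ → g ≈ₚ g′ → f *ₚ g ≈ₚ f′ *ₚ g′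
  *ₚ-cong f≈f′ g≈g′ zero = *-cong (f≈f′ 0) (g≈g′ 0)
  *ₚ-cong f≈f′ g≈g′ (suc n) = +-cong (*-cong (f≈f′ 0) (g≈g′ (suc n))) (*ₚ-cong (f≈f′ ∘ suc) g≈g′ n)

  *ₚ-zeroˡ : ∀ g → 0ₚ *ₚ g ≈ₚ 0ₚ
  *ₚ-zeroˡ g zero = zeroˡ (g 0)
  *ₚ-zeroˡ g (suc n) = trans (+-cong (zeroˡ _) (*ₚ-zeroˡ g n)) (+-identityˡ 0#)

  *ₚ-distribʳ : ∀ f h g → (f +ₚ h) *ₚ g ≈ₚ f *ₚ g +ₚ h *ₚ g
  *ₚ-distribʳ f h g zero = distribʳ (g 0) (f 0) (h 0)
  *ₚ-distribʳ f h g (suc n) =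
    trans (+-cong (distribʳ _ _ _) (*ₚ-distribʳ (f ∘ suc) (h ∘ suc) g n)) (interchange _ _ _ _)

  *ₚ-scaleˡ : ∀ a f g → (λ i → a * f i) *ₚ g ≈ₚ (λ n → a * (f *ₚ g) n)
  *ₚ-scaleˡ a f g zero = *-assoc a (f 0) (g 0)
  *ₚ-scaleˡ a f g (suc n) =
    trans (+-cong (*-assoc a (f 0) _) (*ₚ-scaleˡ a (f ∘ suc) g n)) (sym (distribˡ a _ _))

  *ₚ-last : ∀ f g n → (f *ₚ g) (suc n) ≈ f (suc n) * g 0 + (f *ₚ (g ∘ suc)) n
  *ₚ-last f g zero = +-comm _ _
  *ₚ-last f g (suc n) = begin
      f 0 * g (suc (suc n)) + ((f ∘ suc) *ₚ g) (suc n)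
    ≈⟨ +-congˡ (*ₚ-last (f ∘ suc) g n) ⟩
      f 0 * g (suc (suc n)) + (f (suc (suc n)) * g 0 + ((f ∘ suc) *ₚ (g ∘ suc)) n)
    ≈⟨ x∙yz≈y∙xz _ _ _ ⟩
      f (suc (suc n)) * g 0 + (f 0 * g (suc (suc n)) + ((f ∘ suc) *ₚ (g ∘ suc)) n) ∎

  *ₚ-comm : ∀ f g → f *ₚ g ≈ₚ g *ₚ f
  *ₚ-comm f g zero = *-comm _ _
  *ₚ-comm f g (suc n) = trans (+-cong (*-comm _ _) (*ₚ-comm (f ∘ suc) g n)) (sym (*ₚ-last g f n))

  *ₚ-assoc : ∀ f g h → (f *ₚ g) *ₚ h ≈ₚ f *ₚ (g *ₚ h)
  *ₚ-assoc f g h zero = *-assoc _ _ _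
  *ₚ-assoc f g h (suc n) = begin
      (f 0 * g 0) * h (suc n) + (((λ i → f 0 * g (suc i)) +ₚ (f ∘ suc) *ₚ g) *ₚ h) n
    ≈⟨ +-congˡ (*ₚ-distribʳ (λ i → f 0 * g (suc i)) ((f ∘ suc) *ₚ g) h n) ⟩
      (f 0 * g 0) * h (suc n) + (((λ i → f 0 * g (suc i)) *ₚ h) n + (((f ∘ suc) *ₚ g) *ₚ h) n)
    ≈⟨ +-congˡ (+-cong (*ₚ-scaleˡ (f 0) (g ∘ suc) h n) (*ₚ-assoc (f ∘ suc) g h n)) ⟩
      (f 0 * g 0) * h (suc n) + (f 0 * ((g ∘ suc) *ₚ h) n + ((f ∘ suc) *ₚ (g *ₚ h)) n)
    ≈⟨ sym (+-assoc _ _ _) ⟩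
      ((f 0 * g 0) * h (suc n) + f 0 * ((g ∘ suc) *ₚ h) n) + ((f ∘ suc) *ₚ (g *ₚ h)) n
    ≈⟨ +-congʳ (trans (+-congʳ (*-assoc _ _ _)) (sym (distribˡ _ _ _))) ⟩
      f 0 * (g *ₚ h) (suc n) + ((f ∘ suc) *ₚ (g *ₚ h)) n ∎

  *ₚ-identityˡ : ∀ g → 1ₚ *ₚ g ≈ₚ g
  *ₚ-identityˡ g zero = *-identityˡ _
  *ₚ-identityˡ g (suc n) = trans (+-cong (*-identityˡ _) (*ₚ-zeroˡ g n)) (+-identityʳ _)

  isCommutativeRing : IsCommutativeRing _≈ₚ_ _+ₚ_ _*ₚ_ -ₚ_ 0ₚ 1ₚ
  isCommutativeRing = record
    { isRing = record
      { +-isAbelianGroup = Pointwise.isAbelianGroup ℕ +-isAbelianGroup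
      ; *-cong = *ₚ-cong
      ; *-assoc = *ₚ-assoc
      ; *-identity = *ₚ-identityˡ , λ g n → trans (*ₚ-comm g 1ₚ n) (*ₚ-identityˡ g n)
      ; distrib = (λ f g h n → trans (*ₚ-comm f (g +ₚ h) n)
                                 (trans (*ₚ-distribʳ g h f n) (+-cong (*ₚ-comm g f n) (*ₚ-comm h f n))))
                , (λ f g h → *ₚ-distribʳ g h f)
      }
    ; *-comm = *ₚ-comm
    }

  commutativeRing : CommutativeRing c ℓ
  commutativeRing = record { isCommutativeRing = isCommutativeRing }

  *ₚ-as-Σ : ∀ f g n → (f *ₚ g) n ≈ Σ (applyUpTo (λ i → f i * g (n ∸ i)) (suc n))
  *ₚ-as-Σ f g zero = sym (+-identityʳ _)
  *ₚ-as-Σ f g (suc n) = +-congˡ (*ₚ-as-Σ (f ∘ suc) g n)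

  monomial : Carrier → ℕ → PS
  monomial a i n = if i ≡ᵇ n then a else 0#

  monomial-cong : ∀ {a b} i → a ≈ b → monomial a i ≈ₚ monomial b i
  monomial-cong i a≈b n with i ≡ᵇ n
  ... | true = a≈b
  ... | false = refl

  monomial₀-*ₚ : ∀ a g → monomial a 0 *ₚ g ≈ₚ (λ n → a * g n)
  monomial₀-*ₚ a g zero = refl
  monomial₀-*ₚ a g (suc n) = trans (+-congˡ (*ₚ-zeroˡ g n)) (+-identityʳ _)

  monomial-*ₚ : ∀ a b i j → monomial a i *ₚ monomial b j ≈ₚ monomial (a * b) (i ℕ.+ j)
  monomial-*ₚ a b zero j n = trans (monomial₀-*ₚ a (monomial b j) n) (scale (j ≡ᵇ n))
    where
    scale : ∀ t → a * (if t then b else 0#) ≈ (if t then a * b else 0#)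
    scale true = refl
    scale false = zeroʳ a
  monomial-*ₚ a b (suc i) j zero = zeroˡ _
  monomial-*ₚ a b (suc i) j (suc n) = trans (trans (+-congʳ (zeroˡ _)) (+-identityˡ _)) (monomial-*ₚ a b i j n)

-- Gaussian binomial coefficients

module Gaussian {c ℓ} (R : CommutativeRing c ℓ) (x : CommutativeRing.Carrier R) where
  open CommutativeRing R
  open import Algebra.Properties.Semiring.Exp semiring using (_^_; ^-homo-*)
  open import Algebra.Properties.Ring ring using (x[y-z]≈xy-xz)
  open import Relation.Binary.Reasoning.Setoid setoid
  private
    module *-Solver = CMSolver *-commutativeMonoid
    module +-Solver = CMSolver +-commutativeMonoid

  qPochhammer : ℕ → Carrier
  qPochhammer zero = 1#
  qPochhammer (suc n) = qPochhammer n * (1# - x ^ suc n)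

  qBinomial : ℕ → ℕ → Carrier
  qBinomial t zero = 1#
  qBinomial zero (suc u) = 0#
  qBinomial (suc t) (suc u) = x ^ suc u * qBinomial t (suc u) + qBinomial t u

  qBinomial-vanishes : ∀ {t u} → t < u → qBinomial t u ≈ 0#
  qBinomial-vanishes {zero} {suc u} _ = refl
  qBinomial-vanishes {suc t} {suc u} (s≤s t<u) = begin
      x ^ suc u * qBinomial t (suc u) + qBinomial t u
    ≈⟨ +-cong (*-congˡ (qBinomial-vanishes (ℕₚ.m<n⇒m<1+n t<u))) (qBinomial-vanishes t<u) ⟩
      x ^ suc u * 0# + 0#
    ≈⟨ trans (+-identityʳ _) (zeroʳ _) ⟩
      0# ∎

  qBinomial-diagonal : ∀ u → qBinomial u u ≈ 1#
  qBinomial-diagonal zero = refl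
  qBinomial-diagonal (suc u) = begin
      x ^ suc u * qBinomial u (suc u) + qBinomial u u
    ≈⟨ +-cong (*-congˡ (qBinomial-vanishes (ℕₚ.n<1+n u))) (qBinomial-diagonal u) ⟩
      x ^ suc u * 0# + 1#
    ≈⟨ trans (+-congʳ (zeroʳ _)) (+-identityˡ 1#) ⟩
      1# ∎

  private
    pascal-product : ∀ {a b g₁ g₀ p q P} →
      g₁ * (p * (1# - a)) * q ≈ P → g₀ * p * (q * (1# - b)) ≈ P →
      (a * g₁ + g₀) * (p * (1# - a)) * (q * (1# - b)) ≈ P * (1# - a * b)
    pascal-product {a} {b} {g₁} {g₀} {p} {q} {P} e₁ e₀ = begin
        (a * g₁ + g₀) * (p * (1# - a)) * (q * (1# - b))
      ≈⟨ trans (*-congʳ (distribʳ _ _ _)) (distribʳ _ _ _) ⟩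
        a * g₁ * (p * (1# - a)) * (q * (1# - b)) + g₀ * (p * (1# - a)) * (q * (1# - b))
      ≈⟨ +-cong (let open *-Solver in
                   solve 6 (λ a g₁ p a′ q b′ → ((a ⊕ g₁) ⊕ (p ⊕ a′)) ⊕ (q ⊕ b′)
                                              ⊜ (a ⊕ ((g₁ ⊕ (p ⊕ a′)) ⊕ q)) ⊕ b′)
                         refl a g₁ p (1# - a) q (1# - b))
                (let open *-Solver in
                   solve 5 (λ g₀ p a′ q b′ → (g₀ ⊕ (p ⊕ a′)) ⊕ (q ⊕ b′) ⊜ ((g₀ ⊕ p) ⊕ (q ⊕ b′)) ⊕ a′)
                         refl g₀ p (1# - a) q (1# - b)) ⟩
        a * (g₁ * (p * (1# - a)) * q) * (1# - b) + g₀ * p * (q * (1# - b)) * (1# - a)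
      ≈⟨ +-cong (*-congʳ (*-congˡ e₁)) (*-congʳ e₀) ⟩
        a * P * (1# - b) + P * (1# - a)
      ≈⟨ +-congʳ (trans (*-congʳ (*-comm a P)) (*-assoc P a _)) ⟩
        P * (a * (1# - b)) + P * (1# - a)
      ≈⟨ sym (distribˡ P _ _) ⟩
        P * (a * (1# - b) + (1# - a))
      ≈⟨ *-congˡ (+-congʳ (trans (x[y-z]≈xy-xz a 1# b) (+-congʳ (*-identityʳ a)))) ⟩
        P * ((a - a * b) + (1# - a))
      ≈⟨ *-congˡ (let open +-Solver in
                    solve 4 (λ a ab′ o a′ → (a ⊕ ab′) ⊕ (o ⊕ a′) ⊜ (o ⊕ ab′) ⊕ (a ⊕ a′))
                          refl a (- (a * b)) 1# (- a)) ⟩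
        P * ((1# - a * b) + (a - a))
      ≈⟨ *-congˡ (trans (+-congˡ (-‿inverseʳ a)) (+-identityʳ _)) ⟩
        P * (1# - a * b) ∎

  qBinomial-*-qPochhammer : ∀ {t u} → u ≤ t →
                            qBinomial t u * qPochhammer u * qPochhammer (t ∸ u) ≈ qPochhammer t
  qBinomial-*-qPochhammer {t} {u} u≤t =
    ≡.subst (λ t′ → qBinomial t′ u * qPochhammer u * qPochhammer (t ∸ u) ≈ qPochhammer t′)
            (ℕₚ.m+[n∸m]≡n u≤t) (split u (t ∸ u))
    where
    split : ∀ u d → qBinomial (u ℕ.+ d) u * qPochhammer u * qPochhammer d ≈ qPochhammer (u ℕ.+ d)
    split zero d = trans (*-congʳ (*-identityˡ 1#)) (*-identityˡ _)
    split (suc u) zero rewrite ℕₚ.+-identityʳ u =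
      trans (*-identityʳ _) (trans (*-congʳ (qBinomial-diagonal (suc u))) (*-identityˡ _))
    split (suc u) (suc d) = begin
        qBinomial (suc (u ℕ.+ suc d)) (suc u) * qPochhammer (suc u) * qPochhammer (suc d)
      ≈⟨ pascal-product shorter (split u (suc d)) ⟩
        qPochhammer (u ℕ.+ suc d) * (1# - x ^ suc u * x ^ suc d)
      ≈⟨ *-congˡ (+-congˡ (-‿cong (sym (^-homo-* x (suc u) (suc d))))) ⟩
        qPochhammer (suc u ℕ.+ suc d) ∎
      where
      shorter : qBinomial (u ℕ.+ suc d) (suc u) * qPochhammer (suc u) * qPochhammer d
                ≈ qPochhammer (u ℕ.+ suc d)
      shorter rewrite ℕₚ.+-suc u d = split (suc u) d

-- Opened only from here on, since the generic modules above use the ring names _+_, _*_ and _≈_.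
open import Defs
open import Data.Nat using (_+_; _*_)

-- The structure of BL_k(m)

headSize : List Part → ℕ
headSize [] = 0
headSize (p ∷ _) = size p

plainHead : List Part → Bool
plainHead [] = false
plainHead (p ∷ _) = not (over p)

private
  ∧-fst : ∀ a b → T (a ∧ b) → T a
  ∧-fst true b _ = tt

  ∧-snd : ∀ a b → T (a ∧ b) → T b
  ∧-snd true b t = t

  ∧-congʳ-assuming : ∀ {a a′} b → (T b → a ≡ a′) → a ∧ b ≡ a′ ∧ b
  ∧-congʳ-assuming false _ = ≡.trans (∧-zeroʳ _) (≡.sym (∧-zeroʳ _))
  ∧-congʳ-assuming true a≡a′ = ≡.cong (_∧ true) (a≡a′ tt)

isBLj-by-head : ∀ k m j λs → isBLj k m j λs ≡ (headSize λs ≡ᵇ j) ∧ (plainHead λs ∧ isBL k m λs)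
isBLj-by-head k m j [] = ≡.trans (∧-zeroʳ _) (≡.sym (∧-zeroʳ _))
isBLj-by-head k m j ((s , true) ∷ μ) =
  ≡.trans (≡.cong (isBL k m ((s , true) ∷ μ) ∧_) (∧-zeroʳ _)) (≡.trans (∧-zeroʳ _) (≡.sym (∧-zeroʳ _)))
isBLj-by-head k m j ((s , false) ∷ μ) =
  ≡.trans (≡.cong (isBL k m ((s , false) ∷ μ) ∧_) (∧-identityʳ _)) (∧-comm (isBL k m ((s , false) ∷ μ)) (s ≡ᵇ j))

canPrecede : Part → Part → Bool
canPrecede x y =
  ((1 ≤ᵇ size x) ∧ ovAdj x y) ∧ ((size x ≤ᵇ (size y + 1)) ∧ (over x ∨ (size x <ᵇ (size y + 1))))

isBL-∷-∷ : ∀ k m x y ν → isBL k (suc m) (x ∷ y ∷ ν)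
           ≡ (not (over x) ∨ divides? k (suc (length ν))) ∧ (canPrecede x y ∧ isBL k m (y ∷ ν))
isBL-∷-∷ k m x y ν = let open CMSolver ∧-commutativeMonoid using (solve; _⊜_) renaming (_⊕_ to _∙_) in
  solve 10 (λ a o O d L N E b₁ b₂ B →
             ((a ∙ (o ∙ O)) ∙ ((d ∙ L) ∙ (N ∙ (E ∙ (b₁ ∙ (b₂ ∙ B))))))
           ⊜ (d ∙ (((a ∙ o) ∙ (b₁ ∙ b₂)) ∙ (O ∙ (L ∙ (N ∙ (E ∙ B)))))))
        ≡.refl (1 ≤ᵇ size x) (ovAdj x y) (isOverpartition (y ∷ ν)) (not (over x) ∨ divides? k (suc (length ν)))
        (isLk k (y ∷ ν)) (length (y ∷ ν) ≡ᵇ m) (lastIsOne (y ∷ ν)) (size x ≤ᵇ (size y + 1))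
        (over x ∨ (size x <ᵇ (size y + 1))) (blAdj (y ∷ ν))

canPrecede-plain : ∀ s s′ {b′} → 1 ≤ s′ → canPrecede (s , false) (s′ , b′) ≡ (s′ ≡ᵇ s)
canPrecede-plain zero (suc s′) _ = ≡.refl
canPrecede-plain (suc zero) (suc zero) _ = ≡.refl
canPrecede-plain (suc zero) (suc (suc s′)) _ = ≡.refl
canPrecede-plain (suc (suc s)) (suc zero) _ = ∧-zeroʳ (s <ᵇ 1)
canPrecede-plain (suc (suc s)) (suc (suc s′)) {b′} _ = canPrecede-plain (suc s) (suc s′) {b′} (s≤s z≤n)

canPrecede-over : ∀ s s′ {b′} → canPrecede (s , true) (s′ , b′) ≡ (suc s′ ≡ᵇ s)
canPrecede-over zero s′ = ≡.refl
canPrecede-over (suc zero) zero = ≡.refl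
canPrecede-over (suc zero) (suc s′) = ≡.cong (_∧ _) (∧-zeroʳ (s′ <ᵇ 1))
canPrecede-over (suc (suc s)) zero = ≡.refl
canPrecede-over (suc (suc s)) (suc s′) {b′} = canPrecede-over (suc s) s′ {b′}

isBL-head-positive : ∀ k m y ν → T (isBL k m (y ∷ ν)) → 1 ≤ size y
isBL-head-positive k m y ν t = ℕₚ.≤-pred (ℕₚ.<ᵇ⇒< 1 (suc (size y)) (head-positive ν (∧-fst _ _ t)))
  where
  head-positive : ∀ ν → T (isOverpartition (y ∷ ν)) → T (1 ≤ᵇ size y)
  head-positive [] t = t
  head-positive (z ∷ ν) t = ∧-fst (1 ≤ᵇ size y) _ t

isBL-length : ∀ k m λs → T (isBL k m λs) → length λs ≡ m
isBL-length k m λs t =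
  ℕₚ.≡ᵇ⇒≡ (length λs) m (∧-fst _ _ (∧-snd (isLk k λs) _ (∧-snd (isOverpartition λs) _ t)))

isBL-∷-plain : ∀ k r s μ → isBL k (suc (suc r)) ((s , false) ∷ μ) ≡ (headSize μ ≡ᵇ s) ∧ isBL k (suc r) μ
isBL-∷-plain k r s [] = ≡.trans (∧-zeroʳ (1 ≤ᵇ s)) (≡.sym (∧-zeroʳ (0 ≡ᵇ s)))
isBL-∷-plain k r s (y ∷ ν) =
  ≡.trans (isBL-∷-∷ k (suc r) (s , false) y ν)
          (∧-congʳ-assuming (isBL k (suc r) (y ∷ ν))
                            (λ t → canPrecede-plain s (size y) {over y} (isBL-head-positive k (suc r) y ν t)))

isBL-∷-over : ∀ k r s μ → isBL k (suc (suc r)) ((s , true) ∷ μ)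
              ≡ divides? k (suc r) ∧ ((suc (headSize μ) ≡ᵇ s) ∧ isBL k (suc r) μ)
isBL-∷-over k r s [] =
  ≡.trans (≡.cong ((1 ≤ᵇ s) ∧_) (∧-zeroʳ (divides? k 0 ∧ true)))
          (≡.trans (∧-zeroʳ (1 ≤ᵇ s))
                   (≡.sym (≡.trans (≡.cong (divides? k (suc r) ∧_) (∧-zeroʳ (1 ≡ᵇ s))) (∧-zeroʳ _))))
isBL-∷-over k r s (y ∷ ν) =
  ≡.trans (isBL-∷-∷ k (suc r) (s , true) y ν)
    (≡.trans (≡.cong (λ b → divides? k (suc (length ν)) ∧ (b ∧ isBL k (suc r) (y ∷ ν)))
                     (canPrecede-over s (size y) {over y}))
             (∧-congʳ-assuming _ (λ t → ≡.cong (λ n → divides? k (suc n))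
               (ℕₚ.suc-injective (isBL-length k (suc r) (y ∷ ν) (∧-snd (suc (size y) ≡ᵇ s) _ t))))))

headSize-zero : ∀ k m λs → (headSize λs ≡ᵇ 0) ∧ isBL k m λs ≡ false
headSize-zero k m [] = ∧-zeroʳ (0 ≡ᵇ m)
headSize-zero k m ((zero , b) ∷ []) = ≡.refl
headSize-zero k m ((zero , b) ∷ y ∷ ν) = ≡.refl
headSize-zero k m ((suc s , b) ∷ μ) = ≡.refl

module ℤ[[q]] = PowerSeries +-*-commutativeRing
module ℤΣ = ListSum (CommutativeRing.+-monoid +-*-commutativeRing)
module ℤ[[q]]Σ = ListSum (CommutativeRing.+-monoid ℤ[[q]].commutativeRing)

-- Series a n, the coefficient of z^a q^n, is read as a power series in z over ℤ[[q]].
module ℤ[[q]][[z]] = PowerSeries ℤ[[q]].commutativeRing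
module ℤ[[q,z]] = CommutativeRing ℤ[[q]][[z]].commutativeRing

Σ-coefficient : ∀ (fs : List ℤ[[q]].PS) n → ℤ[[q]]Σ.Σ fs n ≡ ℤΣ.Σ (map (λ f → f n) fs)
Σ-coefficient [] n = ≡.refl
Σ-coefficient (f ∷ fs) n = ≡.cong (λ s → f n ℤ.+ s) (Σ-coefficient fs n)

applyUpTo-as-map : ∀ {a} {A : Set a} (h : ℕ → A) m → applyUpTo h m ≡ map h (upTo m)
applyUpTo-as-map h m = ≡.sym (map-applyUpTo (λ i → i) h m)

⊗≈*ₚ : ∀ f g → f ⊗ g ≈ f ℤ[[q]][[z]].*ₚ g
⊗≈*ₚ f g a n = ≡.sym (begin
    (f ℤ[[q]][[z]].*ₚ g) a n
  ≡⟨ ℤ[[q]][[z]].*ₚ-as-Σ f g a n ⟩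
    ℤ[[q]]Σ.Σ (applyUpTo products (suc a)) n
  ≡⟨ Σ-coefficient (applyUpTo products (suc a)) n ⟩
    ℤΣ.Σ (map (λ h → h n) (applyUpTo products (suc a)))
  ≡⟨ ≡.cong ℤΣ.Σ (≡.trans (map-applyUpTo products (λ h → h n) (suc a))
                          (applyUpTo-as-map (λ i → products i n) (suc a))) ⟩
    ℤΣ.Σ (map (λ i → products i n) (upTo (suc a)))
  ≡⟨ ℤΣ.Σ-map-cong inner (upTo (suc a)) ⟩
    ℤΣ.Σ (map (ℤΣ.Σ ∘ terms) (upTo (suc a)))
  ≡⟨ ≡.cong ℤΣ.Σ (map-∘ {g = ℤΣ.Σ} {f = terms} (upTo (suc a))) ⟩
    ℤΣ.Σ (map ℤΣ.Σ (map terms (upTo (suc a))))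
  ≡⟨ ≡.sym (ℤΣ.Σ-concat (map terms (upTo (suc a)))) ⟩
    (f ⊗ g) a n ∎)
  where
  open ≡.≡-Reasoning
  products : ℕ → ℤ[[q]].PS
  products i = f i ℤ[[q]].*ₚ g (a ∸ i)
  terms : ℕ → List ℤ
  terms i = map (λ m → f i m ℤ.* g (a ∸ i) (n ∸ m)) (upTo (suc n))
  inner : ∀ i → products i n ≡ ℤΣ.Σ (terms i)
  inner i = ≡.trans (ℤ[[q]].*ₚ-as-Σ (f i) (g (a ∸ i)) n)
                    (≡.cong ℤΣ.Σ (applyUpTo-as-map (λ m → f i m ℤ.* g (a ∸ i) (n ∸ m)) (suc n)))

one≈1ₚ : one ≈ ℤ[[q]][[z]].1ₚ
one≈1ₚ zero zero = ≡.refl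
one≈1ₚ zero (suc n) = ≡.refl
one≈1ₚ (suc a) n = ≡.refl

private
  ⊗-via-*ₚ : ∀ {f g f′ g′} → f ℤ[[q]][[z]].*ₚ g ≈ f′ ℤ[[q]][[z]].*ₚ g′ → f ⊗ g ≈ f′ ⊗ g′
  ⊗-via-*ₚ {f} {g} {f′} {g′} eq = ℤ[[q,z]].trans (⊗≈*ₚ f g) (ℤ[[q,z]].trans eq (ℤ[[q,z]].sym (⊗≈*ₚ f′ g′)))

  ⊗-identityˡ : ∀ f → one ⊗ f ≈ f
  ⊗-identityˡ f =
    ℤ[[q,z]].trans (⊗≈*ₚ one f) (ℤ[[q,z]].trans (ℤ[[q,z]].*-congʳ one≈1ₚ) (ℤ[[q,z]].*-identityˡ f))

  ⊗-isCommutativeRing : IsCommutativeRing _≈_ _⊕_ _⊗_ ℤ[[q]][[z]].-ₚ_ ℤ[[q]][[z]].0ₚ one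
  ⊗-isCommutativeRing = record
    { isRing = record
      { +-isAbelianGroup = +-isAbelianGroup
      ; *-cong = λ f≈f′ g≈g′ → ⊗-via-*ₚ (*-cong f≈f′ g≈g′)
      ; *-assoc = λ f g h → ⊗-via-*ₚ (trans (*-congʳ (⊗≈*ₚ f g))
                                            (trans (*-assoc f g h) (*-congˡ (sym (⊗≈*ₚ g h)))))
      ; *-identity = ⊗-identityˡ , λ f → trans (⊗-via-*ₚ (*-comm f one)) (⊗-identityˡ f)
      ; distrib = (λ f g h → trans (⊗≈*ₚ f (g ⊕ h))
                                   (trans (distribˡ f g h) (sym (+-cong (⊗≈*ₚ f g) (⊗≈*ₚ f h)))))
                , (λ h f g → trans (⊗≈*ₚ (f ⊕ g) h)
                                   (trans (distribʳ h f g) (sym (+-cong (⊗≈*ₚ f h) (⊗≈*ₚ g h)))))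
      }
    ; *-comm = λ f g → ⊗-via-*ₚ (*-comm f g)
    }
    where open ℤ[[q,z]]

  mono≈monomial : ∀ a n → mono a n ≈ ℤ[[q]][[z]].monomial (ℤ[[q]].monomial (+ 1) n) a
  mono≈monomial a n a′ n′ with a ≡ᵇ a′
  ... | true = ≡.refl
  ... | false = ≡.refl

  mono-⊗ : ∀ a n b m → mono a n ⊗ mono b m ≈ mono (a + b) (n + m)
  mono-⊗ a n b m = begin
      mono a n ⊗ mono b m
    ≈⟨ ⊗≈*ₚ (mono a n) (mono b m) ⟩
      mono a n ℤ[[q]][[z]].*ₚ mono b m
    ≈⟨ *-cong (mono≈monomial a n) (mono≈monomial b m) ⟩
      monomial (ℤ[[q]].monomial (+ 1) n) a ℤ[[q]][[z]].*ₚ monomial (ℤ[[q]].monomial (+ 1) m) b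
    ≈⟨ monomial-*ₚ _ _ a b ⟩
      monomial (ℤ[[q]].monomial (+ 1) n ℤ[[q]].*ₚ ℤ[[q]].monomial (+ 1) m) (a + b)
    ≈⟨ monomial-cong (a + b) (ℤ[[q]].monomial-*ₚ (+ 1) (+ 1) n m) ⟩
      monomial (ℤ[[q]].monomial (+ 1) (n + m)) (a + b)
    ≈⟨ sym (mono≈monomial (a + b) (n + m)) ⟩
      mono (a + b) (n + m) ∎
    where
    open ℤ[[q,z]] using (setoid; *-cong; sym)
    open ℤ[[q]][[z]] using (monomial; monomial-*ₚ; monomial-cong)
    open import Relation.Binary.Reasoning.Setoid setoid

infixl 6 _+ₛ_
infixl 7 _*ₛ_

-- Opaque copies of the ring operations: unification would otherwise unfold a goal such as
-- f ⊗ g ≈ h down to sums of integers and get stuck.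
opaque
  _+ₛ_ : Series → Series → Series
  _+ₛ_ = _⊕_

  _*ₛ_ : Series → Series → Series
  _*ₛ_ = _⊗_

  -ₛ_ : Series → Series
  -ₛ_ = ℤ[[q]][[z]].-ₚ_

  0ₛ : Series
  0ₛ = ℤ[[q]][[z]].0ₚ

  1ₛ : Series
  1ₛ = one

opaque
  unfolding _+ₛ_ _*ₛ_ -ₛ_ 0ₛ 1ₛ

  series-isCommutativeRing : IsCommutativeRing _≈_ _+ₛ_ _*ₛ_ -ₛ_ 0ₛ 1ₛ
  series-isCommutativeRing = ⊗-isCommutativeRing

  ⊕≈+ₛ : ∀ f g → f ⊕ g ≈ f +ₛ g
  ⊕≈+ₛ f g a n = ≡.refl

  ⊗≈*ₛ : ∀ f g → f ⊗ g ≈ f *ₛ g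
  ⊗≈*ₛ f g a n = ≡.refl

  ⊖≈-ₛ : ∀ f g → f ⊖ g ≈ f +ₛ -ₛ g
  ⊖≈-ₛ f g a n = ≡.refl

  one≈1ₛ : one ≈ 1ₛ
  one≈1ₛ a n = ≡.refl

  +ₛ-coefficient : ∀ f g a n → (f +ₛ g) a n ≡ f a n ℤ.+ g a n
  +ₛ-coefficient f g a n = ≡.refl

  0ₛ-coefficient : ∀ a n → 0ₛ a n ≡ + 0
  0ₛ-coefficient a n = ≡.refl

  mono-*ₛ : ∀ a n b m → mono a n *ₛ mono b m ≈ mono (a + b) (n + m)
  mono-*ₛ = mono-⊗

seriesRing : CommutativeRing 0ℓ 0ℓ
seriesRing = record { isCommutativeRing = series-isCommutativeRing }

open CommutativeRing seriesRing hiding (_≈_; _+_; _*_; -_; 0#; 1#; zero)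
open ListSum +-monoid
open import Relation.Binary.Reasoning.Setoid setoid
open import Algebra.Properties.Semiring.Exp semiring using (_^_)

weightMono : List Part → Series
weightMono λs = mono (numOver λs) (weight λs)

partMono : Part → Series
partMono p = mono (if over p then 1 else 0) (size p)

gfTerm : (List Part → Bool) → List Part → Series
gfTerm P λs = if P λs then weightMono λs else 0ₛ

gf : (List Part → Bool) → List (List Part) → Series
gf P λss = Σ (map (gfTerm P) λss)

gf-coefficient : ∀ P λss a n → gf P λss a n
  ≡ + length (filter (λ λs → T? ((numOver λs ≡ᵇ a) ∧ (weight λs ≡ᵇ n))) (filter (λ λs → T? (P λs)) λss))
gf-coefficient P [] a n = 0ₛ-coefficient a n
gf-coefficient P (λs ∷ λss) a n rewrite +ₛ-coefficient (gfTerm P λs) (gf P λss) a n with P λs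
... | false rewrite 0ₛ-coefficient a n = ≡.trans (ℤₚ.+-identityˡ _) (gf-coefficient P λss a n)
... | true with (numOver λs ≡ᵇ a) ∧ (weight λs ≡ᵇ n)
...   | false = ≡.trans (ℤₚ.+-identityˡ _) (gf-coefficient P λss a n)
...   | true = ≡.cong (λ c → + 1 ℤ.+ c) (gf-coefficient P λss a n)

GL≈gf : ∀ k m j → GL k m j ≈ gf (isBLj k m j) (allLists m (partsUpTo j))
GL≈gf k m j a n = ≡.sym (gf-coefficient (isBLj k m j) (allLists m (partsUpTo j)) a n)

gf-cong : ∀ {P Q} → (∀ λs → P λs ≡ Q λs) → ∀ λss → gf P λss ≈ gf Q λss
gf-cong {P} {Q} P≡Q =
  Σ-map-cong {f = gfTerm P} {g = gfTerm Q}
             (λ λs → reflexive (≡.cong (λ b → if b then weightMono λs else 0ₛ) (P≡Q λs)))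

gf-false : ∀ λss → gf (λ _ → false) λss ≈ 0ₛ
gf-false = Σ-map-zero {f = gfTerm (λ _ → false)} (λ _ → refl)

gf-∧-false : ∀ {d} (Q : List Part → Bool) λss → d ≡ false → gf (λ μ → d ∧ Q μ) λss ≈ 0ₛ
gf-∧-false Q λss ≡.refl = gf-false λss

gf-∧-true : ∀ {d} (Q : List Part → Bool) λss → d ≡ true → gf (λ μ → d ∧ Q μ) λss ≈ gf Q λss
gf-∧-true Q λss ≡.refl = refl

gf-++ : ∀ P λss μss → gf P (λss ++ μss) ≈ gf P λss +ₛ gf P μss
gf-++ P λss μss =
  trans (reflexive (≡.cong Σ (map-++ (gfTerm P) λss μss))) (Σ-++ (map (gfTerm P) λss) (map (gfTerm P) μss))

gf-map-∷ : ∀ P p λss → gf P (map (p ∷_) λss) ≈ partMono p *ₛ gf (λ μ → P (p ∷ μ)) λss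
gf-map-∷ P p [] = sym (zeroʳ _)
gf-map-∷ P p (μ ∷ λss) = trans (+-cong first (gf-map-∷ P p λss)) (sym (distribˡ _ _ _))
  where
  first : gfTerm P (p ∷ μ) ≈ partMono p *ₛ gfTerm (λ μ → P (p ∷ μ)) μ
  first with P (p ∷ μ)
  ... | true = sym (mono-*ₛ (if over p then 1 else 0) (size p) (numOver μ) (weight μ))
  ... | false = sym (zeroʳ _)

gf-allLists-suc : ∀ P r ps →
  gf P (allLists (suc r) ps) ≈ Σ (map (λ p → partMono p *ₛ gf (λ μ → P (p ∷ μ)) (allLists r ps)) ps)
gf-allLists-suc P r ps = go ps
  where
  go : ∀ qs → gf P (concatMap (λ p → map (p ∷_) (allLists r ps)) qs)
              ≈ Σ (map (λ p → partMono p *ₛ gf (λ μ → P (p ∷ μ)) (allLists r ps)) qs)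
  go [] = refl
  go (q ∷ qs) = trans (gf-++ P (map (q ∷_) (allLists r ps)) _) (+-cong (gf-map-∷ P q (allLists r ps)) (go qs))

Σ-partsUpTo-single : ∀ {j s} (F : Part → Series) → s ≤ j → (∀ s′ b → s′ ≢ s → F (s′ , b) ≈ 0ₛ) →
                     Σ (map F (partsUpTo j)) ≈ F (s , false) +ₛ F (s , true)
Σ-partsUpTo-single {j} {s} F s≤j F≈0 = begin
    Σ (map F (partsUpTo j))
  ≡⟨ ≡.cong Σ (map-concatMap F both (upTo (suc j))) ⟩
    Σ (concat (map (map F ∘ both) (upTo (suc j))))
  ≈⟨ Σ-concat (map (map F ∘ both) (upTo (suc j))) ⟩
    Σ (map Σ (map (map F ∘ both) (upTo (suc j))))
  ≡⟨ ≡.cong Σ (≡.trans (≡.sym (map-∘ (upTo (suc j)))) (map-applyUpTo (λ i → i) (Σ ∘ map F ∘ both) (suc j))) ⟩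
    Σ (applyUpTo (Σ ∘ map F ∘ both) (suc j))
  ≈⟨ Σ-applyUpTo-single (s≤s s≤j) vanish ⟩
    F (s , false) +ₛ (F (s , true) +ₛ 0ₛ)
  ≈⟨ +-congˡ (+-identityʳ _) ⟩
    F (s , false) +ₛ F (s , true) ∎
  where
  both : ℕ → List Part
  both s = (s , false) ∷ (s , true) ∷ []
  vanish : ∀ s′ → s′ ≢ s → F (s′ , false) +ₛ (F (s′ , true) +ₛ 0ₛ) ≈ 0ₛ
  vanish s′ s′≢s = trans (+-cong (F≈0 s′ false s′≢s) (trans (+-identityʳ _) (F≈0 s′ true s′≢s))) (+-identityʳ 0ₛ)

gf-by-head : ∀ {j s} (Q : List Part → Bool) r → s ≤ j →
  gf (λ λs → (headSize λs ≡ᵇ s) ∧ Q λs) (allLists (suc r) (partsUpTo j))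
  ≈ mono 0 s *ₛ gf (λ μ → Q ((s , false) ∷ μ)) (allLists r (partsUpTo j))
    +ₛ mono 1 s *ₛ gf (λ μ → Q ((s , true) ∷ μ)) (allLists r (partsUpTo j))
gf-by-head {j} {s} Q r s≤j =
  trans (gf-allLists-suc P r (partsUpTo j))
        (trans (Σ-partsUpTo-single F s≤j vanish) (+-cong (at false) (at true)))
  where
  P : List Part → Bool
  P λs = (headSize λs ≡ᵇ s) ∧ Q λs
  F : Part → Series
  F p = partMono p *ₛ gf (λ μ → P (p ∷ μ)) (allLists r (partsUpTo j))
  vanish : ∀ s′ b → s′ ≢ s → F (s′ , b) ≈ 0ₛ
  vanish s′ b s′≢s rewrite dec-false (s′ ≟ s) s′≢s =
    trans (*-congˡ (gf-false (allLists r (partsUpTo j)))) (zeroʳ _)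
  at : ∀ b → F (s , b) ≈ partMono (s , b) *ₛ gf (λ μ → Q ((s , b) ∷ μ)) (allLists r (partsUpTo j))
  at b rewrite dec-true (s ≟ s) ≡.refl = refl

-- Generating functions of BL_k(m) by the size of the first part

pairMono : ℕ → ℕ → Series
pairMono u n = mono u n +ₛ mono (suc u) n

mono-*ₛ-pairMono : ∀ a n b m → mono a n *ₛ pairMono b m ≈ pairMono (a + b) (n + m)
mono-*ₛ-pairMono a n b m =
  trans (distribˡ (mono a n) (mono b m) (mono (suc b) m))
        (+-cong (mono-*ₛ a n b m)
                (trans (mono-*ₛ a n (suc b) m) (reflexive (≡.cong (λ c → mono c (n + m)) (ℕₚ.+-suc a b)))))

*ₛ-absorbˡ : ∀ {x y z} f → x *ₛ y ≈ z → x *ₛ (y *ₛ f) ≈ z *ₛ f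
*ₛ-absorbˡ {x} {y} f xy≈z = trans (sym (*-assoc x y f)) (*-congʳ xy≈z)

suc-C-2 : ∀ u → suc u C 2 ≡ u + u C 2
suc-C-2 u = ≡.sym (≡.trans (≡.cong (_+ u C 2) (≡.sym (nC1≡n u))) (nCk+nC[k+1]≡[n+1]C[k+1] u 1))

module HeadGF (k′ : ℕ) where

  k : ℕ
  k = suc k′

  open Gaussian seriesRing (mono 0 k) public

  -- Only parts of size ≤ j are enumerated, which loses nothing when the first part has size s ≤ j.
  headGF : ℕ → ℕ → ℕ → Series
  headGF j m s = gf (λ λs → (headSize λs ≡ᵇ s) ∧ isBL k m λs) (allLists m (partsUpTo j))

  GL≈headGF : ∀ j r → GL k (suc (suc r)) j ≈ mono 0 j *ₛ headGF j (suc r) j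
  GL≈headGF j r = begin
      GL k (suc (suc r)) j
    ≈⟨ GL≈gf k (suc (suc r)) j ⟩
      gf (isBLj k (suc (suc r)) j) (allLists (suc (suc r)) (partsUpTo j))
    ≈⟨ gf-cong (isBLj-by-head k (suc (suc r)) j) (allLists (suc (suc r)) (partsUpTo j)) ⟩
      gf (λ λs → (headSize λs ≡ᵇ j) ∧ (plainHead λs ∧ isBL k (suc (suc r)) λs))
         (allLists (suc (suc r)) (partsUpTo j))
    ≈⟨ gf-by-head (λ λs → plainHead λs ∧ isBL k (suc (suc r)) λs) (suc r) ℕₚ.≤-refl ⟩
      mono 0 j *ₛ gf (λ μ → isBL k (suc (suc r)) ((j , false) ∷ μ)) L +ₛ mono 1 j *ₛ gf (λ _ → false) L
    ≈⟨ +-cong (*-congˡ (gf-cong (isBL-∷-plain k r j) L)) (trans (*-congˡ (gf-false L)) (zeroʳ _)) ⟩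
      mono 0 j *ₛ headGF j (suc r) j +ₛ 0ₛ
    ≈⟨ +-identityʳ _ ⟩
      mono 0 j *ₛ headGF j (suc r) j ∎
    where
    L : List (List Part)
    L = allLists (suc r) (partsUpTo j)

  headGF-step : ∀ {j} r s → s ≤ j →
    headGF j (suc (suc r)) s
    ≈ mono 0 s *ₛ headGF j (suc r) s
      +ₛ mono 1 s *ₛ gf (λ μ → divides? k (suc r) ∧ ((suc (headSize μ) ≡ᵇ s) ∧ isBL k (suc r) μ))
                        (allLists (suc r) (partsUpTo j))
  headGF-step {j} r s s≤j =
    trans (gf-by-head (isBL k (suc (suc r))) (suc r) s≤j)
          (+-cong (*-congˡ (gf-cong (isBL-∷-plain k r s) (allLists (suc r) (partsUpTo j))))
                  (*-congˡ (gf-cong (isBL-∷-over k r s) (allLists (suc r) (partsUpTo j)))))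

  headGF-step-inside : ∀ {j} r s → s ≤ j → divides? k (suc r) ≡ false →
    headGF j (suc (suc r)) s ≈ mono 0 s *ₛ headGF j (suc r) s
  headGF-step-inside {j} r s s≤j k∤ = begin
      headGF j (suc (suc r)) s
    ≈⟨ headGF-step r s s≤j ⟩
      mono 0 s *ₛ headGF j (suc r) s +ₛ mono 1 s *ₛ gf (λ μ → divides? k (suc r) ∧ Q μ) L
    ≈⟨ +-congˡ (trans (*-congˡ (gf-∧-false Q L k∤)) (zeroʳ (mono 1 s))) ⟩
      mono 0 s *ₛ headGF j (suc r) s +ₛ 0ₛ
    ≈⟨ +-identityʳ _ ⟩
      mono 0 s *ₛ headGF j (suc r) s ∎
    where
    Q : List Part → Bool
    Q μ = (suc (headSize μ) ≡ᵇ s) ∧ isBL k (suc r) μ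
    L : List (List Part)
    L = allLists (suc r) (partsUpTo j)

  headGF-step-boundary : ∀ {j} r s → suc s ≤ j → divides? k (suc r) ≡ true →
    headGF j (suc (suc r)) (suc s)
    ≈ mono 0 (suc s) *ₛ headGF j (suc r) (suc s) +ₛ mono 1 (suc s) *ₛ headGF j (suc r) s
  headGF-step-boundary {j} r s s<j k∣ =
    trans (headGF-step r (suc s) s<j)
          (+-congˡ (*-congˡ (gf-∧-true (λ μ → (headSize μ ≡ᵇ s) ∧ isBL k (suc r) μ)
                                       (allLists (suc r) (partsUpTo j)) k∣)))

  headGF-zero : ∀ j m → headGF j m 0 ≈ 0ₛ
  headGF-zero j m =
    trans (gf-cong (headSize-zero k m) (allLists m (partsUpTo j))) (gf-false (allLists m (partsUpTo j)))

  headGF-one : ∀ {j} → 1 ≤ j → headGF j 1 1 ≈ pairMono 0 1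
  headGF-one 1≤j = trans (gf-by-head (isBL k 1) 0 1≤j) (+-cong (single 0) (single 1))
    where
    single : ∀ a → mono a 1 *ₛ (mono 0 0 +ₛ 0ₛ) ≈ mono a 1
    single a = trans (*-congˡ (trans (+-identityʳ _) one≈1ₛ)) (*-identityʳ _)

  headGF-one-vanishes : ∀ {j} s → suc (suc s) ≤ j → headGF j 1 (suc (suc s)) ≈ 0ₛ
  headGF-one-vanishes s s<j =
    trans (gf-by-head (isBL k 1) 0 s<j) (trans (+-cong (vanish 0) (vanish 1)) (+-identityʳ 0ₛ))
    where
    vanish : ∀ a → mono a (suc (suc s)) *ₛ gf (λ _ → false) ([] ∷ []) ≈ 0ₛ
    vanish a = trans (*-congˡ (gf-false ([] ∷ []))) (zeroʳ _)

  divides?-inside : ∀ t i → suc i < k → divides? k (suc i + k * t) ≡ false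
  divides?-inside t i i<k = ≡.cong (_≡ᵇ 0)
    (≡.trans (≡.cong (λ n → (suc i + n) % k) (ℕₚ.*-comm k t))
             (≡.trans ([m+kn]%n≡m%n (suc i) t k) (m≤n⇒m%n≡m (ℕₚ.≤-pred i<k))))

  divides?-boundary : ∀ t → divides? k (k + k * t) ≡ true
  divides?-boundary t = ≡.cong (_≡ᵇ 0) (≡.trans (≡.cong (λ n → (k + n) % k) (ℕₚ.*-comm k t)) (m*n%n≡0 (suc t) k))

  headGF-within-block : ∀ {j} t i s → i < k → s ≤ j →
    headGF j (suc (i + k * t)) s ≈ mono 0 (i * s) *ₛ headGF j (suc (k * t)) s
  headGF-within-block {j} t zero s _ _ = sym (trans (*-congʳ one≈1ₛ) (*-identityˡ _))
  headGF-within-block {j} t (suc i) s i<k s≤j = begin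
      headGF j (suc (suc (i + k * t))) s
    ≈⟨ headGF-step-inside (i + k * t) s s≤j (divides?-inside t i i<k) ⟩
      mono 0 s *ₛ headGF j (suc (i + k * t)) s
    ≈⟨ *-congˡ (headGF-within-block t i s (ℕₚ.<-trans (ℕₚ.n<1+n i) i<k) s≤j) ⟩
      mono 0 s *ₛ (mono 0 (i * s) *ₛ headGF j (suc (k * t)) s)
    ≈⟨ *ₛ-absorbˡ (headGF j (suc (k * t)) s) (mono-*ₛ 0 s 0 (i * s)) ⟩
      mono 0 (suc i * s) *ₛ headGF j (suc (k * t)) s ∎

  headGF-next-block : ∀ {j} t s → suc s ≤ j →
    headGF j (suc (k * suc t)) (suc s)
    ≈ mono 0 (k * suc s) *ₛ headGF j (suc (k * t)) (suc s) +ₛ mono 1 (suc s + k′ * s) *ₛ headGF j (suc (k * t)) s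
  headGF-next-block {j} t s s<j = begin
      headGF j (suc (k * suc t)) (suc s)
    ≡⟨ ≡.cong (λ m → headGF j (suc m) (suc s)) (ℕₚ.*-suc k t) ⟩
      headGF j (suc (suc (k′ + k * t))) (suc s)
    ≈⟨ headGF-step-boundary (k′ + k * t) s s<j (divides?-boundary t) ⟩
      mono 0 (suc s) *ₛ headGF j (suc (k′ + k * t)) (suc s) +ₛ mono 1 (suc s) *ₛ headGF j (suc (k′ + k * t)) s
    ≈⟨ +-cong (*-congˡ (headGF-within-block t k′ (suc s) ℕₚ.≤-refl s<j))
              (*-congˡ (headGF-within-block t k′ s ℕₚ.≤-refl (ℕₚ.<⇒≤ s<j))) ⟩
      mono 0 (suc s) *ₛ (mono 0 (k′ * suc s) *ₛ headGF j (suc (k * t)) (suc s))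
        +ₛ mono 1 (suc s) *ₛ (mono 0 (k′ * s) *ₛ headGF j (suc (k * t)) s)
    ≈⟨ +-cong (*ₛ-absorbˡ (headGF j (suc (k * t)) (suc s)) (mono-*ₛ 0 (suc s) 0 (k′ * suc s)))
              (*ₛ-absorbˡ (headGF j (suc (k * t)) s) (mono-*ₛ 1 (suc s) 0 (k′ * s))) ⟩
      mono 0 (k * suc s) *ₛ headGF j (suc (k * t)) (suc s) +ₛ mono 1 (suc s + k′ * s) *ₛ headGF j (suc (k * t)) s ∎

  mono-^ : ∀ n → mono 0 k ^ n ≈ mono 0 (k * n)
  mono-^ zero = trans (sym one≈1ₛ) (reflexive (≡.cong (mono 0) (≡.sym (ℕₚ.*-zeroʳ k))))
  mono-^ (suc n) = begin
      mono 0 k *ₛ mono 0 k ^ n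
    ≈⟨ *-congˡ (mono-^ n) ⟩
      mono 0 k *ₛ mono 0 (k * n)
    ≈⟨ mono-*ₛ 0 k 0 (k * n) ⟩
      mono 0 (k + k * n)
    ≡⟨ ≡.cong (mono 0) (≡.sym (ℕₚ.*-suc k n)) ⟩
      mono 0 (k * suc n) ∎

  poch≈qPochhammer : ∀ n → poch k n ≈ qPochhammer n
  poch≈qPochhammer zero = one≈1ₛ
  poch≈qPochhammer (suc n) = begin
      poch k n ⊗ (one ⊖ mono 0 (k * suc n))
    ≈⟨ ⊗≈*ₛ (poch k n) (one ⊖ mono 0 (k * suc n)) ⟩
      poch k n *ₛ (one ⊖ mono 0 (k * suc n))
    ≈⟨ *-cong (poch≈qPochhammer n)
              (trans (⊖≈-ₛ one (mono 0 (k * suc n))) (+-cong one≈1ₛ (-‿cong (sym (mono-^ (suc n)))))) ⟩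
      qPochhammer (suc n) ∎

  pairMono-qBinomial-step : ∀ t u N →
    pairMono (suc u) (k * suc u + N) *ₛ qBinomial t (suc u) +ₛ pairMono (suc u) N *ₛ qBinomial t u
    ≈ pairMono (suc u) N *ₛ qBinomial (suc t) (suc u)
  pairMono-qBinomial-step t u N = begin
      pairMono (suc u) (k * suc u + N) *ₛ qBinomial t (suc u) +ₛ pairMono (suc u) N *ₛ qBinomial t u
    ≈⟨ +-congʳ (trans (*-congʳ (sym (mono-*ₛ-pairMono 0 (k * suc u) (suc u) N)))
                      (trans (*-congʳ (*-comm (mono 0 (k * suc u)) (pairMono (suc u) N))) (*-assoc _ _ _))) ⟩
      pairMono (suc u) N *ₛ (mono 0 (k * suc u) *ₛ qBinomial t (suc u)) +ₛ pairMono (suc u) N *ₛ qBinomial t u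
    ≈⟨ sym (distribˡ (pairMono (suc u) N) _ _) ⟩
      pairMono (suc u) N *ₛ (mono 0 (k * suc u) *ₛ qBinomial t (suc u) +ₛ qBinomial t u)
    ≈⟨ *-congˡ (+-congʳ (*-congʳ (sym (mono-^ (suc u))))) ⟩
      pairMono (suc u) N *ₛ qBinomial (suc t) (suc u) ∎

  headGF-first-block : ∀ {j} u → suc u ≤ j →
    headGF j (suc (k * 0)) (suc u) ≈ pairMono u (k * 0 + suc u + k * (u C 2)) *ₛ qBinomial 0 u
  headGF-first-block {j} zero u<j = begin
      headGF j (suc (k * 0)) 1
    ≡⟨ ≡.cong (λ m → headGF j (suc m) 1) (ℕₚ.*-zeroʳ k) ⟩
      headGF j 1 1
    ≈⟨ headGF-one u<j ⟩
      pairMono 0 1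
    ≈⟨ sym (*-identityʳ _) ⟩
      pairMono 0 1 *ₛ 1ₛ
    ≡⟨ ≡.cong (λ n → pairMono 0 n *ₛ 1ₛ) (exponent k′) ⟩
      pairMono 0 (k * 0 + 1 + k * 0) *ₛ 1ₛ ∎
    where
    exponent : ∀ k′ → 1 ≡ suc k′ * 0 + 1 + suc k′ * 0
    exponent = solve-∀
  headGF-first-block {j} (suc u) u<j = begin
      headGF j (suc (k * 0)) (suc (suc u))
    ≡⟨ ≡.cong (λ m → headGF j (suc m) (suc (suc u))) (ℕₚ.*-zeroʳ k) ⟩
      headGF j 1 (suc (suc u))
    ≈⟨ headGF-one-vanishes u u<j ⟩
      0ₛ
    ≈⟨ sym (zeroʳ _) ⟩
      pairMono (suc u) (k * 0 + suc (suc u) + k * (suc u C 2)) *ₛ 0ₛ ∎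

  headGF-closed : ∀ {j} t u → suc u ≤ j →
    headGF j (suc (k * t)) (suc u) ≈ pairMono u (k * t + suc u + k * (u C 2)) *ₛ qBinomial t u
  headGF-closed zero u u<j = headGF-first-block u u<j
  headGF-closed {j} (suc t) zero u<j = begin
      headGF j (suc (k * suc t)) 1
    ≈⟨ headGF-next-block t 0 u<j ⟩
      mono 0 (k * 1) *ₛ headGF j (suc (k * t)) 1 +ₛ mono 1 (1 + k′ * 0) *ₛ headGF j (suc (k * t)) 0
    ≈⟨ +-cong (*-congˡ (headGF-closed t 0 u<j)) (trans (*-congˡ (headGF-zero j (suc (k * t)))) (zeroʳ _)) ⟩
      mono 0 (k * 1) *ₛ (pairMono 0 (k * t + 1 + k * 0) *ₛ 1ₛ) +ₛ 0ₛ
    ≈⟨ trans (+-identityʳ _) (*ₛ-absorbˡ 1ₛ (mono-*ₛ-pairMono 0 (k * 1) 0 (k * t + 1 + k * 0))) ⟩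
      pairMono 0 (k * 1 + (k * t + 1 + k * 0)) *ₛ 1ₛ
    ≡⟨ ≡.cong (λ n → pairMono 0 n *ₛ 1ₛ) (exponent k′ t) ⟩
      pairMono 0 (k * suc t + 1 + k * 0) *ₛ 1ₛ ∎
    where
    exponent : ∀ k′ t → suc k′ * 1 + (suc k′ * t + 1 + suc k′ * 0) ≡ suc k′ * suc t + 1 + suc k′ * 0
    exponent = solve-∀
  headGF-closed {j} (suc t) (suc u) u<j = begin
      headGF j (suc (k * suc t)) (suc (suc u))
    ≈⟨ headGF-next-block t (suc u) u<j ⟩
      mono 0 (k * suc (suc u)) *ₛ headGF j (suc (k * t)) (suc (suc u))
        +ₛ mono 1 (suc (suc u) + k′ * suc u) *ₛ headGF j (suc (k * t)) (suc u)
    ≈⟨ +-cong (*-congˡ (headGF-closed t (suc u) u<j)) (*-congˡ (headGF-closed t u (ℕₚ.<⇒≤ u<j))) ⟩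
      mono 0 (k * suc (suc u)) *ₛ (pairMono (suc u) N₁ *ₛ qBinomial t (suc u))
        +ₛ mono 1 (suc (suc u) + k′ * suc u) *ₛ (pairMono u N₀ *ₛ qBinomial t u)
    ≈⟨ +-cong (*ₛ-absorbˡ (qBinomial t (suc u)) (mono-*ₛ-pairMono 0 (k * suc (suc u)) (suc u) N₁))
              (*ₛ-absorbˡ (qBinomial t u) (mono-*ₛ-pairMono 1 (suc (suc u) + k′ * suc u) u N₀)) ⟩
      pairMono (suc u) (k * suc (suc u) + N₁) *ₛ qBinomial t (suc u)
        +ₛ pairMono (suc u) (suc (suc u) + k′ * suc u + N₀) *ₛ qBinomial t u
    ≡⟨ ≡.cong₂ (λ n n′ → pairMono (suc u) n *ₛ qBinomial t (suc u) +ₛ pairMono (suc u) n′ *ₛ qBinomial t u)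
               (shift k′ t u (suc u C 2))
               (≡.trans (stay k′ t u (u C 2))
                        (≡.cong (λ c → k * suc t + suc (suc u) + k * c) (≡.sym (suc-C-2 u)))) ⟩
      pairMono (suc u) (k * suc u + N) *ₛ qBinomial t (suc u) +ₛ pairMono (suc u) N *ₛ qBinomial t u
    ≈⟨ pairMono-qBinomial-step t u N ⟩
      pairMono (suc u) N *ₛ qBinomial (suc t) (suc u) ∎
    where
    N₁ N₀ N : ℕ
    N₁ = k * t + suc (suc u) + k * (suc u C 2)
    N₀ = k * t + suc u + k * (u C 2)
    N = k * suc t + suc (suc u) + k * (suc u C 2)
    shift : ∀ k′ t u c → suc k′ * suc (suc u) + (suc k′ * t + suc (suc u) + suc k′ * c)
                         ≡ suc k′ * suc u + (suc k′ * suc t + suc (suc u) + suc k′ * c)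
    shift = solve-∀
    stay : ∀ k′ t u c → suc (suc u) + k′ * suc u + (suc k′ * t + suc u + suc k′ * c)
                        ≡ suc k′ * suc t + suc (suc u) + suc k′ * (u + c)
    stay = solve-∀

  GL-closed : ∀ t u →
    GL k (k * suc t + 1) (suc u) ≈ pairMono u (k * (suc u C 2) + suc u + k * suc t) *ₛ qBinomial t u
  GL-closed t u = begin
      GL k (k * suc t + 1) (suc u)
    ≡⟨ ≡.cong (λ m → GL k m (suc u)) (length-eq k′ t) ⟩
      GL k (suc (suc (k′ + k * t))) (suc u)
    ≈⟨ GL≈headGF (suc u) (k′ + k * t) ⟩
      mono 0 (suc u) *ₛ headGF (suc u) (suc (k′ + k * t)) (suc u)
    ≈⟨ *-congˡ (headGF-within-block t k′ (suc u) ℕₚ.≤-refl ℕₚ.≤-refl) ⟩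
      mono 0 (suc u) *ₛ (mono 0 (k′ * suc u) *ₛ headGF (suc u) (suc (k * t)) (suc u))
    ≈⟨ *ₛ-absorbˡ (headGF (suc u) (suc (k * t)) (suc u)) (mono-*ₛ 0 (suc u) 0 (k′ * suc u)) ⟩
      mono 0 (k * suc u) *ₛ headGF (suc u) (suc (k * t)) (suc u)
    ≈⟨ *-congˡ (headGF-closed t u ℕₚ.≤-refl) ⟩
      mono 0 (k * suc u) *ₛ (pairMono u (k * t + suc u + k * (u C 2)) *ₛ qBinomial t u)
    ≈⟨ *ₛ-absorbˡ (qBinomial t u) (mono-*ₛ-pairMono 0 (k * suc u) u (k * t + suc u + k * (u C 2))) ⟩
      pairMono u (k * suc u + (k * t + suc u + k * (u C 2))) *ₛ qBinomial t u
    ≡⟨ ≡.cong (λ n → pairMono u n *ₛ qBinomial t u)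
              (≡.trans (exponent k′ t u (u C 2)) (≡.cong (λ c → k * c + suc u + k * suc t) (≡.sym (suc-C-2 u)))) ⟩
      pairMono u (k * (suc u C 2) + suc u + k * suc t) *ₛ qBinomial t u ∎
    where
    length-eq : ∀ k′ t → suc k′ * suc t + 1 ≡ suc (suc (k′ + suc k′ * t))
    length-eq = solve-∀
    exponent : ∀ k′ t u c → suc k′ * suc u + (suc k′ * t + suc u + suc k′ * c)
                            ≡ suc k′ * (u + c) + suc u + suc k′ * suc t
    exponent = solve-∀

-- The denominators of the q-binomial are cleared; the identity holds for j = 1 too, so 2 ≤ j is unused.
lemma3p7 : (k m j : ℕ) → 1 ≤ k → 2 ≤ j → j < m →
    GL k (k * (m ∸ 1) + 1) j ⊗ (poch k (j ∸ 1) ⊗ poch k (m ∸ 1 ∸ j))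
      ≈ (mono (j ∸ 1) (k * (j C 2) + j + k * (m ∸ 1)) ⊕ mono j (k * (j C 2) + j + k * (m ∸ 1)))
        ⊗ poch k (m ∸ 2)
lemma3p7 zero _ _ () _ _
lemma3p7 (suc k′) (suc (suc t)) (suc u) _ _ (s≤s (s≤s u≤t)) = begin
    GL k (k * suc t + 1) (suc u) ⊗ (poch k u ⊗ poch k (t ∸ u))
  ≈⟨ trans (⊗≈*ₛ (GL k (k * suc t + 1) (suc u)) (poch k u ⊗ poch k (t ∸ u)))
           (*-cong (GL-closed t u) (trans (⊗≈*ₛ (poch k u) (poch k (t ∸ u)))
                                          (*-cong (poch≈qPochhammer u) (poch≈qPochhammer (t ∸ u))))) ⟩
    pairMono u N *ₛ qBinomial t u *ₛ (qPochhammer u *ₛ qPochhammer (t ∸ u))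
  ≈⟨ trans (*-assoc _ _ _) (*-congˡ (trans (sym (*-assoc _ _ _)) (qBinomial-*-qPochhammer u≤t))) ⟩
    pairMono u N *ₛ qPochhammer t
  ≈⟨ sym (trans (⊗≈*ₛ (mono u N ⊕ mono (suc u) N) (poch k t))
                (*-cong (⊕≈+ₛ (mono u N) (mono (suc u) N)) (poch≈qPochhammer t))) ⟩
    (mono u N ⊕ mono (suc u) N) ⊗ poch k t ∎
  where
  open HeadGF k′
  N : ℕ
  N = k * (suc u C 2) + suc u + k * suc t
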